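{- Let $n\ge1$, let $\pi$ be a permutation of $[n]$ and let $\beta$ be a prefix block-interchange. If $c_1(G(\pi\beta))-c_1(G(\pi))\ge 2$, then $f(\pi\beta)-f(\pi)\neq 1$.
   Context: Permutations of $[n]=\{1,\dots,n\}$ are written as sequences $\pi=\langle\pi_1\,\pi_2\cdots\pi_n\rangle$ with $\pi_i=\pi(i)$; products are compositions applied right to left, so $(\pi\sigma)_i=\pi_{\sigma(i)}$. For $1\le i<j\le k<\ell\le n+1$, the block-interchange $\beta(i,j,k,\ell)$ is the permutation $\langle 1\cdots i-1\;\; k\cdots \ell-1\;\; j\cdots k-1\;\; i\cdots j-1\;\; \ell\cdots n\rangle$, so that $\pi\beta(i,j,k,\ell)$ is obtained from $\pi$ by exchanging the blocks $\pi_i\cdots\pi_{j-1}$ and $\pi_k\cdots\pi_{\ell-1}$. A prefix block-interchange is a block-interchange with $i=1$. Breakpoint graph: let $\pi'=(\pi'_0,\dots,\pi'_{2n+1})$ with $\pi'_0=0$, $\pi'_{2n+1}=2n+1$ and $(\pi'_{2i-1},\pi'_{2i})=(2\pi_i-1,2\pi_i)$ for $1\le i\le n$. $G(\pi)$ is the graph on vertex set $\{0,\dots,2n+1\}$ with black edges $\{\pi'_{2i},\pi'_{2i+1}\}$ for $0\le i\le n$ and grey edges $\{2i,2i+1\}$ for $0\le i\le n$. It decomposes uniquely into edge-disjoint cycles alternating black and grey edges; the length of a cycle is its number of black edges; $c_1(G(\pi))$ is the number of cycles of length $1$. $f(\pi)=0$ if $\pi_1=1$ and $f(\pi)=1$ otherwise.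 -}

module Defs where

open import Data.Nat using (ℕ; zero; suc; _+_; _*_; _∸_; _<_; _≤_; _<ᵇ_; _≟_)
open import Data.Nat.Properties using (_<?_)
open import Data.Fin using (Fin; toℕ)
open import Data.Fin.Permutation using (Permutation; _⟨$⟩ʳ_)
open import Data.Bool using (Bool; true; false; if_then_else_)
open import Data.List using (List; upTo; map)
open import Data.Nat.ListAction using (sum)
open import Data.Bool.ListAction using (any)
open import Data.Product using (_×_; _,_)
open import Data.Integer using (ℤ; +_)
open import Relation.Nullary.Decidable using (⌊_⌋; _⊎-dec_; _×-dec_)
open import Relation.Nullary using (yes; no)

-- A permutation of [n] as a 1-based sequence: seq π i = π_i for 1 ≤ i ≤ n
-- (values in {1..n}); outside {1..n} it is 0 (never used).
seq : {n : ℕ} → Permutation n n → ℕ → ℕ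
seq {n} π zero = 0
seq {n} π (suc m) with m <? n
... | yes m<n = suc (toℕ (π ⟨$⟩ʳ Data.Fin.fromℕ< m<n))
... | no _ = 0

-- The block-interchange β(i,j,k,l) as a map on positions (1-based):
-- β = ⟨1 ⋯ i-1, k ⋯ l-1, j ⋯ k-1, i ⋯ j-1, l ⋯ n⟩.
blockInterchange : ℕ → ℕ → ℕ → ℕ → ℕ → ℕ
blockInterchange i j k l p =
  if p <ᵇ i then p
  else if p <ᵇ i + (l ∸ k) then k + (p ∸ i)
  else if p <ᵇ i + (l ∸ k) + (k ∸ j) then j + (p ∸ (i + (l ∸ k)))
  else if p <ᵇ l then i + (p ∸ (i + (l ∸ k) + (k ∸ j)))
  else p

_·_ : (ℕ → ℕ) → (ℕ → ℕ) → (ℕ → ℕ)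
(σ · β) p = σ (β p)

ext : ℕ → (ℕ → ℕ) → ℕ → ℕ
ext n σ zero = 0
ext n σ (suc m) = if m <ᵇ n then σ (suc m) else suc n

-- π'_t for 0 ≤ t ≤ 2n+1: π'_0 = 0, π'_{2n+1} = 2n+1,
-- (π'_{2i-1}, π'_{2i}) = (2π_i - 1, 2π_i).
π′ : ℕ → (ℕ → ℕ) → ℕ → ℕ
π′ n σ zero = 0
π′ n σ (suc t) with t <ᵇ 2 * n
... | false = suc (2 * n)
... | true = if Data.Nat._%_ t 2 Data.Nat.≡ᵇ 0
               then 2 * σ (suc (Data.Nat._/_ t 2)) ∸ 1
               else 2 * σ (suc (Data.Nat._/_ t 2))

blackEdge : ℕ → (ℕ → ℕ) → ℕ → ℕ × ℕ
blackEdge n σ i = π′ n σ (2 * i) , π′ n σ (suc (2 * i))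

greyEdge : ℕ → ℕ × ℕ
greyEdge j = 2 * j , suc (2 * j)

sameEdge : ℕ × ℕ → ℕ × ℕ → Bool
sameEdge (a , b) (c , d) =
  ⌊ ((a ≟ c) ×-dec (b ≟ d)) ⊎-dec ((a ≟ d) ×-dec (b ≟ c)) ⌋

-- A cycle of length 1 in G(π) consists of one black edge and one grey
-- edge with the same two endpoints; c₁ counts the black edges that form
-- such a cycle (each black edge lies in exactly one cycle).
c₁ : ℕ → (ℕ → ℕ) → ℕ
c₁ n σ = sum (map (λ i → if any (λ j → sameEdge (blackEdge n σ i) (greyEdge j))
                                (upTo (suc n))
                          then 1 else 0)
                  (upTo (suc n)))

f : (ℕ → ℕ) → ℤ
f σ = if σ 1 Data.Nat.≡ᵇ 1 then + 0 else + 1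

{-# OPTIONS --safe #-}
-- c₁(G(σ)) counts the adjacencies (consecutive entries x, x + 1) of the extended sequence
-- 0 σ₁ ⋯ σₙ n+1, because a black edge {2x, 2y − 1} is a grey edge exactly when y = x + 1.
-- Write π = B₁ B₂ B₃ B₄, so that πβ = B₃ B₂ B₁ B₄. If f(πβ) − f(π) = 1 then π₁ = 1 and
-- (πβ)₁ ≠ 1: π has the adjacency 0, 1 while πβ has none at its start. Adjacencies inside the
-- blocks are common to both, and the junction of πβ in front of B₁ is not one, since B₁
-- starts with 1 and all entries are positive. So πβ gains at most two junction adjacencies
-- and loses 0, 1, hence c₁ grows by at most one.
module Submission where

open import Defs
open import Data.Nat using (ℕ; zero; suc; _+_; _*_; _∸_; _≤_; _<_; _<ᵇ_; _≡ᵇ_; _≟_; s≤s; z≤n; z<s; s<s; _%_; _/_)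
open import Data.Nat.Properties
open import Data.Nat.Divisibility using (m∣m*n; n∣m⇒m%n≡0)
open import Data.Nat.DivMod using (/-congˡ; m*n/n≡m; %-remove-+ʳ; +-distrib-/-∣ʳ)
open import Data.Nat.ListAction using (sum)
open import Data.Nat.Tactic.RingSolver using (solve-∀)
open import Data.Integer using (+_; _-_)
import Data.Integer as ℤ
import Data.Integer.Properties as ℤₚ
open import Data.Bool using (Bool; true; false; if_then_else_; T)
open import Data.Bool.ListAction using (any)
open import Data.Fin.Permutation using (Permutation)
open import Data.Fin.Properties using (toℕ<n)
open import Data.List using (List; []; _∷_; [_]; _++_; applyUpTo; upTo)
open import Data.List.Properties using (++-assoc; map-upTo; applyUpTo-∷ʳ)
open import Data.List.Relation.Unary.All as All using (All; []; _∷_)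
open import Data.List.Relation.Unary.All.Properties using (++⁺; ++⁻ˡ; ++⁻ʳ; applyUpTo⁺₁)
open import Data.List.Relation.Unary.Any using (satisfied)
open import Data.List.Relation.Unary.Any.Properties using (any⁺; any⁻)
open import Data.List.Membership.Propositional using (lose)
open import Data.List.Membership.Propositional.Properties using (∈-upTo⁺)
open import Data.Product using (_×_; _,_; proj₁; proj₂)
open import Data.Sum using (_⊎_; inj₁; inj₂)
open import Function using (_∘_; _⇔_; mk⇔; Equivalence)
open import Relation.Nullary using (yes; no; contradiction)
open import Relation.Nullary.Reflects using (Reflects; fromEquivalence; det)
open import Relation.Nullary.Decidable using (dec-true; dec-false; toWitness; fromWitness; proof; _×-dec_; _⊎-dec_)
open import Relation.Binary.PropositionalEquality using (_≡_; _≢_; refl; sym; trans; cong; cong₂; subst; module ≡-Reasoning)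

<ᵇ-true : ∀ {m n} → m < n → (m <ᵇ n) ≡ true
<ᵇ-true {m} {n} = dec-true (m <? n)

<ᵇ-false : ∀ {m n} → n ≤ m → (m <ᵇ n) ≡ false
<ᵇ-false {m} {n} n≤m = dec-false (m <? n) (≤⇒≯ n≤m)

adjacency : ℕ → ℕ → ℕ
adjacency x y = if y ≡ᵇ suc x then 1 else 0

adjacency≤1 : ∀ x y → adjacency x y ≤ 1
adjacency≤1 x y with y ≡ᵇ suc x
... | true = ≤-refl
... | false = z≤n

adjacencies : List ℕ → ℕ
adjacencies (x ∷ y ∷ ys) = adjacency x y + adjacencies (y ∷ ys)
adjacencies _ = 0

adjacencies-++-≥ : ∀ xs ys → adjacencies xs + adjacencies ys ≤ adjacencies (xs ++ ys)
adjacencies-++-≥ [] ys = ≤-refl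
adjacencies-++-≥ (x ∷ []) [] = z≤n
adjacencies-++-≥ (x ∷ []) (y ∷ ys) = m≤n+m _ (adjacency x y)
adjacencies-++-≥ (x ∷ x′ ∷ xs) ys = begin
  adjacency x x′ + adjacencies (x′ ∷ xs) + adjacencies ys
    ≡⟨ +-assoc (adjacency x x′) _ _ ⟩
  adjacency x x′ + (adjacencies (x′ ∷ xs) + adjacencies ys)
    ≤⟨ +-monoʳ-≤ (adjacency x x′) (adjacencies-++-≥ (x′ ∷ xs) ys) ⟩
  adjacency x x′ + adjacencies (x′ ∷ xs ++ ys) ∎
  where open ≤-Reasoning

adjacencies-++-≤ : ∀ xs ys → adjacencies (xs ++ ys) ≤ suc (adjacencies xs + adjacencies ys)
adjacencies-++-≤ [] ys = n≤1+n _
adjacencies-++-≤ (x ∷ []) [] = z≤n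
adjacencies-++-≤ (x ∷ []) (y ∷ ys) = +-monoˡ-≤ (adjacencies (y ∷ ys)) (adjacency≤1 x y)
adjacencies-++-≤ (x ∷ x′ ∷ xs) ys = begin
  adjacency x x′ + adjacencies (x′ ∷ xs ++ ys)
    ≤⟨ +-monoʳ-≤ (adjacency x x′) (adjacencies-++-≤ (x′ ∷ xs) ys) ⟩
  adjacency x x′ + suc (adjacencies (x′ ∷ xs) + adjacencies ys)
    ≡⟨ +-suc (adjacency x x′) _ ⟩
  suc (adjacency x x′ + (adjacencies (x′ ∷ xs) + adjacencies ys))
    ≡⟨ cong suc (+-assoc (adjacency x x′) _ _) ⟨
  suc (adjacency x x′ + adjacencies (x′ ∷ xs) + adjacencies ys) ∎
  where open ≤-Reasoning

adjacencies-++-nonadjacent : ∀ xs {y} ys → All (λ x → y ≢ suc x) xs →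
  adjacencies (xs ++ y ∷ ys) ≡ adjacencies xs + adjacencies (y ∷ ys)
adjacencies-++-nonadjacent [] ys [] = refl
adjacencies-++-nonadjacent (x ∷ []) {y} ys (y≢1+x ∷ []) =
  cong (λ b → (if b then 1 else 0) + adjacencies (y ∷ ys)) (dec-false (y ≟ suc x) y≢1+x)
adjacencies-++-nonadjacent (x ∷ x′ ∷ xs) ys (_ ∷ nonadj) =
  trans (cong (_+_ (adjacency x x′)) (adjacencies-++-nonadjacent (x′ ∷ xs) ys nonadj))
        (sym (+-assoc (adjacency x x′) _ _))

adjacencies-exchange-≤ : ∀ {x z} xs ys zs ws → x ≡ 1 → z ≢ 1 →
  All (0 <_) ((x ∷ xs) ++ ys ++ (z ∷ zs) ++ ws) →
  adjacencies (0 ∷ (z ∷ zs) ++ ys ++ (x ∷ xs) ++ ws) ≤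
  suc (adjacencies (0 ∷ (x ∷ xs) ++ ys ++ (z ∷ zs) ++ ws))
adjacencies-exchange-≤ {z = z} xs ys zs ws refl z≢1 positive = begin
  adjacencies (0 ∷ Z ++ ys ++ X ++ ws)
    ≡⟨ adjacencies-++-nonadjacent [ 0 ] (zs ++ ys ++ X ++ ws) (z≢1 ∷ []) ⟩
  adjacencies (Z ++ ys ++ X ++ ws)
    ≡⟨ cong adjacencies (++-assoc Z ys (X ++ ws)) ⟨
  adjacencies ((Z ++ ys) ++ X ++ ws)
    ≡⟨ adjacencies-++-nonadjacent (Z ++ ys) (xs ++ ws) (All.map 0<v⇒1≢1+v (++⁺ Z-positive ys-positive)) ⟩
  adjacencies (Z ++ ys) + adjacencies (X ++ ws)
    ≤⟨ +-mono-≤ (adjacencies-++-≤ Z ys) (adjacencies-++-≤ X ws) ⟩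
  suc (adjacencies Z + adjacencies ys) + suc (adjacencies X + adjacencies ws)
    ≡⟨ rearrange (adjacencies X) (adjacencies ys) (adjacencies Z) (adjacencies ws) ⟩
  suc (suc (adjacencies X + (adjacencies ys + (adjacencies Z + adjacencies ws))))
    ≤⟨ s≤s (s≤s blocks≤whole) ⟩
  suc (adjacencies (0 ∷ X ++ ys ++ Z ++ ws)) ∎
  where
  open ≤-Reasoning
  X Z : List ℕ
  X = 1 ∷ xs
  Z = z ∷ zs
  ys-positive : All (0 <_) ys
  ys-positive = ++⁻ˡ ys (++⁻ʳ X positive)
  Z-positive : All (0 <_) Z
  Z-positive = ++⁻ˡ Z (++⁻ʳ ys (++⁻ʳ X positive))
  0<v⇒1≢1+v : ∀ {v} → 0 < v → 1 ≢ suc v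
  0<v⇒1≢1+v 0<v 1≡1+v = <-irrefl (suc-injective 1≡1+v) 0<v
  rearrange : ∀ a y c w → suc (c + y) + suc (a + w) ≡ suc (suc (a + (y + (c + w))))
  rearrange = solve-∀
  blocks≤whole : adjacencies X + (adjacencies ys + (adjacencies Z + adjacencies ws)) ≤
                 adjacencies (X ++ ys ++ Z ++ ws)
  blocks≤whole = begin
    adjacencies X + (adjacencies ys + (adjacencies Z + adjacencies ws))
      ≤⟨ +-monoʳ-≤ (adjacencies X) (+-monoʳ-≤ (adjacencies ys) (adjacencies-++-≥ Z ws)) ⟩
    adjacencies X + (adjacencies ys + adjacencies (Z ++ ws))
      ≤⟨ +-monoʳ-≤ (adjacencies X) (adjacencies-++-≥ ys (Z ++ ws)) ⟩
    adjacencies X + adjacencies (ys ++ Z ++ ws)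
      ≤⟨ adjacencies-++-≥ X (ys ++ Z ++ ws) ⟩
    adjacencies (X ++ ys ++ Z ++ ws) ∎

segment : (ℕ → ℕ) → ℕ → ℕ → List ℕ
segment g s len = applyUpTo (λ t → g (s + t)) len

applyUpTo-cong : ∀ {g h : ℕ → ℕ} len → (∀ {t} → t < len → g t ≡ h t) →
                 applyUpTo g len ≡ applyUpTo h len
applyUpTo-cong zero g≗h = refl
applyUpTo-cong (suc len) g≗h = cong₂ _∷_ (g≗h z<s) (applyUpTo-cong len (g≗h ∘ s<s))

applyUpTo-++ : ∀ (g : ℕ → ℕ) m len ws →
  applyUpTo g (m + len) ++ ws ≡ applyUpTo g m ++ applyUpTo (λ t → g (m + t)) len ++ ws
applyUpTo-++ g zero len ws = refl
applyUpTo-++ g (suc m) len ws = cong (g 0 ∷_) (applyUpTo-++ (g ∘ suc) m len ws)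

segment-++ : ∀ g s m len ws → segment g s (m + len) ++ ws ≡ segment g s m ++ segment g (s + m) len ++ ws
segment-++ g s m len ws = trans (applyUpTo-++ _ m len ws)
  (cong (λ zs → segment g s m ++ zs ++ ws) (applyUpTo-cong len (λ {t} _ → cong g (sym (+-assoc s m t)))))

segment-++₄ : ∀ g s w x y z ws → segment g s (w + (x + (y + z))) ++ ws ≡
  segment g s w ++ segment g (s + w) x ++ segment g (s + w + x) y ++ segment g (s + w + x + y) z ++ ws
segment-++₄ g s w x y z ws =
  trans (segment-++ g s w (x + (y + z)) ws) (cong (segment g s w ++_)
  (trans (segment-++ g (s + w) x (y + z) ws) (cong (segment g (s + w) x ++_)
  (segment-++ g (s + w + x) y z ws))))

segment-· : ∀ (σ β : ℕ → ℕ) s s′ len → (∀ {t} → t < len → β (s + t) ≡ s′ + t) →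
  segment (σ · β) s len ≡ segment σ s′ len
segment-· σ β s s′ len translates = applyUpTo-cong len (cong σ ∘ translates)

module BlockInterchangeWithLengths (i c b a : ℕ) where

  β : ℕ → ℕ
  β = blockInterchange i (i + c) (i + c + b) (i + c + b + a)

  β-first : ∀ {t} → t < a → β (i + t) ≡ i + c + b + t
  β-first {t} t<a rewrite m+n∸m≡n (i + c + b) a | m+n∸m≡n (i + c) b
    | <ᵇ-false (m≤m+n i t) | <ᵇ-true (+-monoʳ-< i t<a) | m+n∸m≡n i t = refl

  β-middle : ∀ {t} → t < b → β (i + a + t) ≡ i + c + t
  β-middle {t} t<b rewrite m+n∸m≡n (i + c + b) a | m+n∸m≡n (i + c) b
    | <ᵇ-false (≤-trans (m≤m+n i a) (m≤m+n (i + a) t)) | <ᵇ-false (m≤m+n (i + a) t)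
    | <ᵇ-true (+-monoʳ-< (i + a) t<b) | m+n∸m≡n (i + a) t = refl

  private
    i+a+b+c≡l : i + a + b + c ≡ i + c + b + a
    i+a+b+c≡l = reorder i a b c
      where
      reorder : ∀ i a b c → i + a + b + c ≡ i + c + b + a
      reorder = solve-∀

    i+a+b≤l : i + a + b ≤ i + c + b + a
    i+a+b≤l = ≤-trans (m≤m+n (i + a + b) c) (≤-reflexive i+a+b+c≡l)

  β-last : ∀ {t} → t < c → β (i + a + b + t) ≡ i + t
  β-last {t} t<c rewrite m+n∸m≡n (i + c + b) a | m+n∸m≡n (i + c) b
    | <ᵇ-false (≤-trans (m≤m+n i a) (≤-trans (m≤m+n (i + a) b) (m≤m+n (i + a + b) t)))
    | <ᵇ-false (≤-trans (m≤m+n (i + a) b) (m≤m+n (i + a + b) t)) | <ᵇ-false (m≤m+n (i + a + b) t)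
    | <ᵇ-true (<-≤-trans (+-monoʳ-< (i + a + b) t<c) (≤-reflexive i+a+b+c≡l))
    | m+n∸m≡n (i + a + b) t = refl

  β-suffix : ∀ {p} → i + c + b + a ≤ p → β p ≡ p
  β-suffix {p} l≤p rewrite m+n∸m≡n (i + c + b) a | m+n∸m≡n (i + c) b
    | <ᵇ-false (≤-trans (m≤m+n i a) (≤-trans (m≤m+n (i + a) b) (≤-trans i+a+b≤l l≤p)))
    | <ᵇ-false (≤-trans (m≤m+n (i + a) b) (≤-trans i+a+b≤l l≤p))
    | <ᵇ-false (≤-trans i+a+b≤l l≤p) | <ᵇ-false l≤p = refl

2*i%2≡0 : ∀ i → (2 * i) % 2 ≡ 0
2*i%2≡0 i = n∣m⇒m%n≡0 (2 * i) 2 (m∣m*n i)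

2*i/2≡i : ∀ i → (2 * i) / 2 ≡ i
2*i/2≡i i = trans (/-congˡ (*-comm 2 i)) (m*n/n≡m i 2)

[1+2*i]%2≡1 : ∀ i → suc (2 * i) % 2 ≡ 1
[1+2*i]%2≡1 i = %-remove-+ʳ 1 {d = 2} (m∣m*n i)

[1+2*i]/2≡i : ∀ i → suc (2 * i) / 2 ≡ i
[1+2*i]/2≡i i = trans (+-distrib-/-∣ʳ 1 {d = 2} (m∣m*n i)) (2*i/2≡i i)

module _ (n : ℕ) (σ : ℕ → ℕ) where

  ext-inside : ∀ {m} → m < n → ext n σ (suc m) ≡ σ (suc m)
  ext-inside m<n rewrite <ᵇ-true m<n = refl

  ext-last : ext n σ (suc n) ≡ suc n
  ext-last rewrite <ᵇ-false (≤-refl {n}) = refl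

  ext-≤ : (∀ p → σ p ≤ n) → ∀ p → ext n σ p ≤ suc n
  ext-≤ σ≤n zero = z≤n
  ext-≤ σ≤n (suc m) with m <ᵇ n
  ... | true = m≤n⇒m≤1+n (σ≤n (suc m))
  ... | false = ≤-refl

  π′-odd : ∀ {i} → i < n → π′ n σ (suc (2 * i)) ≡ 2 * σ (suc i) ∸ 1
  π′-odd {i} i<n rewrite <ᵇ-true (*-monoʳ-< 2 i<n) | 2*i%2≡0 i | 2*i/2≡i i = refl

  π′-even : ∀ {i} → i < n → π′ n σ (suc (suc (2 * i))) ≡ 2 * σ (suc i)
  π′-even {i} i<n
    rewrite <ᵇ-true (≤-trans (≤-reflexive (sym (*-suc 2 i))) (*-monoʳ-≤ 2 i<n))
          | [1+2*i]%2≡1 i | [1+2*i]/2≡i i = refl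

  π′-last : π′ n σ (suc (2 * n)) ≡ suc (2 * n)
  π′-last rewrite <ᵇ-false (≤-refl {2 * n}) = refl

  blackEdge-ext : ∀ {i} → i ≤ n → blackEdge n σ i ≡ (2 * ext n σ i , 2 * ext n σ (suc i) ∸ 1)
  blackEdge-ext i≤n = cong₂ _,_ (left i≤n) (right (m≤n⇒m<n∨m≡n i≤n))
    where
    open ≡-Reasoning
    left : ∀ {i} → i ≤ n → π′ n σ (2 * i) ≡ 2 * ext n σ i
    left {zero} _ = refl
    left {suc i} i<n = begin
      π′ n σ (2 * suc i)          ≡⟨ cong (π′ n σ) (*-suc 2 i) ⟩
      π′ n σ (suc (suc (2 * i))) ≡⟨ π′-even i<n ⟩
      2 * σ (suc i)              ≡⟨ cong (2 *_) (ext-inside i<n) ⟨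
      2 * ext n σ (suc i)        ∎
    right : ∀ {i} → i < n ⊎ i ≡ n → π′ n σ (suc (2 * i)) ≡ 2 * ext n σ (suc i) ∸ 1
    right (inj₁ i<n) = trans (π′-odd i<n) (cong (λ v → 2 * v ∸ 1) (sym (ext-inside i<n)))
    right (inj₂ refl) = begin
      π′ n σ (suc (2 * n))    ≡⟨ π′-last ⟩
      suc (2 * n)             ≡⟨ cong (_∸ 1) (*-suc 2 n) ⟨
      2 * suc n ∸ 1           ≡⟨ cong (λ v → 2 * v ∸ 1) ext-last ⟨
      2 * ext n σ (suc n) ∸ 1 ∎

sameEdge⇔ : ∀ {a b c d} → T (sameEdge (a , b) (c , d)) ⇔ ((a ≡ c × b ≡ d) ⊎ (a ≡ d × b ≡ c))
sameEdge⇔ {a} {b} {c} {d} = mk⇔ (toWitness {a? = same?}) (fromWitness {a? = same?})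
  where
  same? = ((a ≟ c) ×-dec (b ≟ d)) ⊎-dec ((a ≟ d) ×-dec (b ≟ c))

greyEdge-match : ∀ {x y g} → T (sameEdge (2 * x , 2 * y ∸ 1) (greyEdge g)) → y ≡ suc x
greyEdge-match {x} {y} {g} same with Equivalence.to sameEdge⇔ same
... | inj₂ (2x≡1+2g , _) = contradiction 2x≡1+2g (even≢odd x g)
... | inj₁ (2x≡2g , 2y∸1≡1+2g) with y
...   | zero = contradiction 2y∸1≡1+2g λ ()
...   | suc y′ = cong suc (trans y′≡g (sym (*-cancelˡ-≡ x g 2 2x≡2g)))
  where
  y′≡g : y′ ≡ g
  y′≡g = *-cancelˡ-≡ y′ g 2 (suc-injective (trans (cong (_∸ 1) (sym (*-suc 2 y′))) 2y∸1≡1+2g))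

greyEdge-reflects : ∀ {n x y} → y ≤ suc n →
  Reflects (y ≡ suc x) (any (λ g → sameEdge (2 * x , 2 * y ∸ 1) (greyEdge g)) (upTo (suc n)))
greyEdge-reflects {n} {x} {y} y≤1+n = fromEquivalence sound complete
  where
  matches : ℕ → Bool
  matches g = sameEdge (2 * x , 2 * y ∸ 1) (greyEdge g)
  sound : T (any matches (upTo (suc n))) → y ≡ suc x
  sound t = let g , g-matches = satisfied (any⁻ matches (upTo (suc n)) t) in greyEdge-match {x} {y} {g} g-matches
  complete : y ≡ suc x → T (any matches (upTo (suc n)))
  complete refl = any⁺ matches (lose (∈-upTo⁺ y≤1+n)
    (Equivalence.from sameEdge⇔ (inj₁ (refl , cong (_∸ 1) (*-suc 2 x)))))

adjacencies-applyUpTo : ∀ (e : ℕ → ℕ) m →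
  adjacencies (applyUpTo e (suc (suc m))) ≡ sum (applyUpTo (λ i → adjacency (e i) (e (suc i))) (suc m))
adjacencies-applyUpTo e zero = refl
adjacencies-applyUpTo e (suc m) = cong (_+_ (adjacency (e 0) (e 1))) (adjacencies-applyUpTo (e ∘ suc) m)

c₁≡adjacencies : ∀ n σ → (∀ p → σ p ≤ n) → c₁ n σ ≡ adjacencies (0 ∷ segment σ 1 n ++ [ suc n ])
c₁≡adjacencies n σ σ≤n = begin
  c₁ n σ
    ≡⟨ cong sum (map-upTo G (suc n)) ⟩
  sum (applyUpTo G (suc n))
    ≡⟨ cong sum (applyUpTo-cong (suc n) G≡adjacency) ⟩
  sum (applyUpTo (λ i → adjacency (E i) (E (suc i))) (suc n))
    ≡⟨ adjacencies-applyUpTo E n ⟨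
  adjacencies (0 ∷ applyUpTo (E ∘ suc) (suc n))
    ≡⟨ cong (λ xs → adjacencies (0 ∷ xs)) extended ⟩
  adjacencies (0 ∷ segment σ 1 n ++ [ suc n ]) ∎
  where
  open ≡-Reasoning
  E : ℕ → ℕ
  E = ext n σ
  G : ℕ → ℕ
  G i = if any (λ j → sameEdge (blackEdge n σ i) (greyEdge j)) (upTo (suc n)) then 1 else 0
  G≡adjacency : ∀ {i} → i < suc n → G i ≡ adjacency (E i) (E (suc i))
  G≡adjacency {i} (s≤s i≤n) = begin
    G i
      ≡⟨ cong (λ e → if any (λ j → sameEdge e (greyEdge j)) (upTo (suc n)) then 1 else 0) (blackEdge-ext n σ i≤n) ⟩
    (if any (λ j → sameEdge (2 * E i , 2 * E (suc i) ∸ 1) (greyEdge j)) (upTo (suc n)) then 1 else 0)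
      ≡⟨ cong (λ b → if b then 1 else 0)
              (det (greyEdge-reflects (ext-≤ n σ σ≤n (suc i))) (proof (E (suc i) ≟ suc (E i)))) ⟩
    adjacency (E i) (E (suc i)) ∎
  extended : applyUpTo (E ∘ suc) (suc n) ≡ segment σ 1 n ++ [ suc n ]
  extended = trans (sym (applyUpTo-∷ʳ (E ∘ suc) n))
                   (cong₂ (λ xs x → xs ++ [ x ]) (applyUpTo-cong n (ext-inside n σ)) (ext-last n σ))

c₁-prefixBlockInterchange-≤ : ∀ {n} (σ : ℕ → ℕ) c b a r → 0 < c → 0 < a → c + b + a + r ≡ n →
  (∀ p → σ p ≤ n) → (∀ {m} → m < n → 0 < σ (suc m)) → σ 1 ≡ 1 →
  (σ · blockInterchange 1 (1 + c) (1 + c + b) (1 + c + b + a)) 1 ≢ 1 →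
  c₁ n (σ · blockInterchange 1 (1 + c) (1 + c + b) (1 + c + b + a)) ≤ suc (c₁ n σ)
c₁-prefixBlockInterchange-≤ {n} σ c@(suc c′) b a@(suc a′) r (s≤s z≤n) (s≤s z≤n) n≡ σ≤n σ>0 σ₁≡1 τ₁≢1 =
  begin
  c₁ n τ
    ≡⟨ c₁≡adjacencies n τ (σ≤n ∘ β) ⟩
  adjacencies (0 ∷ segment τ 1 n ++ [ suc n ])
    ≡⟨ cong (λ xs → adjacencies (0 ∷ xs)) τ-blocks ⟩
  adjacencies (0 ∷ P₃ ++ P₂ ++ P₁ ++ P₄ ++ [ suc n ])
    ≤⟨ exchange ⟩
  suc (adjacencies (0 ∷ P₁ ++ P₂ ++ P₃ ++ P₄ ++ [ suc n ]))
    ≡⟨ cong (λ xs → suc (adjacencies (0 ∷ xs))) σ-blocks ⟨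
  suc (adjacencies (0 ∷ segment σ 1 n ++ [ suc n ]))
    ≡⟨ cong suc (c₁≡adjacencies n σ σ≤n) ⟨
  suc (c₁ n σ) ∎
  where
  open ≤-Reasoning
  open BlockInterchangeWithLengths 1 c b a
  reversed : ∀ a b c t → 1 + a + b + c + t ≡ 1 + c + b + a + t
  reversed = solve-∀
  reversed-lengths : ∀ c b a r → c + b + a + r ≡ a + (b + (c + r))
  reversed-lengths = solve-∀
  τ : ℕ → ℕ
  τ = σ · β
  P₁ P₂ P₃ P₄ P₁-tail P₃-tail : List ℕ
  P₁ = segment σ 1 c
  P₂ = segment σ (1 + c) b
  P₃ = segment σ (1 + c + b) a
  P₄ = segment σ (1 + c + b + a) r
  P₁-tail = segment σ 2 c′
  P₃-tail = applyUpTo (λ t → σ (1 + c + b + suc t)) a′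
  σ-blocks : segment σ 1 n ++ [ suc n ] ≡ P₁ ++ P₂ ++ P₃ ++ P₄ ++ [ suc n ]
  σ-blocks = trans (cong (λ m → segment σ 1 m ++ [ suc n ])
                         (trans (sym n≡) (trans (+-assoc (c + b) a r) (+-assoc c b (a + r)))))
                   (segment-++₄ σ 1 c b a r [ suc n ])
  suffix-fixed : ∀ {t} → t < r → β (1 + a + b + c + t) ≡ 1 + c + b + a + t
  suffix-fixed {t} _ =
    trans (β-suffix (≤-trans (m≤m+n (1 + c + b + a) t) (≤-reflexive (sym (reversed a b c t)))))
          (reversed a b c t)
  τ-blocks : segment τ 1 n ++ [ suc n ] ≡ P₃ ++ P₂ ++ P₁ ++ P₄ ++ [ suc n ]
  τ-blocks = trans (cong (λ m → segment τ 1 m ++ [ suc n ]) (trans (sym n≡) (reversed-lengths c b a r)))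
    (trans (segment-++₄ τ 1 a b c r [ suc n ])
      (cong₂ _++_ (segment-· σ β 1 (1 + c + b) a β-first)
      (cong₂ _++_ (segment-· σ β (1 + a) (1 + c) b β-middle)
      (cong₂ _++_ (segment-· σ β (1 + a + b) 1 c β-last)
      (cong (_++ [ suc n ]) (segment-· σ β (1 + a + b + c) (1 + c + b + a) r suffix-fixed))))))
  positive : All (0 <_) (P₁ ++ P₂ ++ P₃ ++ P₄ ++ [ suc n ])
  positive = subst (All (0 <_)) σ-blocks (++⁺ (applyUpTo⁺₁ _ n σ>0) (z<s ∷ []))
  exchange : adjacencies (0 ∷ P₃ ++ P₂ ++ P₁ ++ P₄ ++ [ suc n ]) ≤
             suc (adjacencies (0 ∷ P₁ ++ P₂ ++ P₃ ++ P₄ ++ [ suc n ]))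
  exchange = adjacencies-exchange-≤ P₁-tail P₂ P₃-tail (P₄ ++ [ suc n ])
               σ₁≡1 (τ₁≢1 ∘ trans (cong σ (β-first z<s))) positive

seq-≤ : ∀ {n} (π : Permutation n n) p → seq π p ≤ n
seq-≤ π zero = z≤n
seq-≤ {n} π (suc m) with m <? n
... | yes _ = toℕ<n _
... | no _ = z≤n

seq-positive : ∀ {n} (π : Permutation n n) {m} → m < n → 0 < seq π (suc m)
seq-positive {n} π {m} m<n with m <? n
... | yes _ = z<s
... | no m≮n = contradiction m<n m≮n

f-difference≡1 : ∀ (σ τ : ℕ → ℕ) → f τ - f σ ≡ + 1 → σ 1 ≡ 1 × τ 1 ≢ 1
f-difference≡1 σ τ jump with σ 1 ≡ᵇ 1 in σ₁≡ᵇ1 | τ 1 ≡ᵇ 1 in τ₁≡ᵇ1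
f-difference≡1 σ τ jump | true | false =
  ≡ᵇ⇒≡ (σ 1) 1 (subst T (sym σ₁≡ᵇ1) _) , λ τ₁≡1 → subst T τ₁≡ᵇ1 (≡⇒≡ᵇ (τ 1) 1 τ₁≡1)
f-difference≡1 _ _ () | true | true
f-difference≡1 _ _ () | false | true
f-difference≡1 _ _ () | false | false

m≤1+n⇒m-n≤1 : ∀ {m n} → m ≤ suc n → + m - + n ℤ.≤ + 1
m≤1+n⇒m-n≤1 {m} {n} m≤1+n = begin
  + m - + n       ≡⟨ ℤₚ.m-n≡m⊖n m n ⟩
  m ℤ.⊖ n         ≤⟨ ℤₚ.⊖-monoˡ-≤ n m≤1+n ⟩
  suc n ℤ.⊖ n     ≡⟨ ℤₚ.≤-⊖ (n≤1+n n) ⟩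
  + (suc n ∸ n)   ≡⟨ cong +_ (m+n∸n≡m 1 n) ⟩
  + 1             ∎
  where open ℤₚ.≤-Reasoning

lemma3p9 : (n : ℕ) → 1 ≤ n → (π : Permutation n n) →
             (j k l : ℕ) → 1 < j → j ≤ k → k < l → l ≤ ℕ.suc n →
             let σ = seq π
                 σβ = σ · blockInterchange 1 j k l
             in Data.Integer._≤_ (+ 2) ((+ c₁ n σβ) - (+ c₁ n σ)) →
                f σβ - f σ ≢ + 1
lemma3p9 n _ π j k l 1<j j≤k k<l l≤1+n c₁-gain f-gain
  with c , refl ← m≤n⇒∃[o]m+o≡n 1<j
     | b , refl ← m≤n⇒∃[o]m+o≡n j≤k
     | a , refl ← m≤n⇒∃[o]m+o≡n (<⇒≤ k<l)
     | r , l+r≡1+n ← m≤n⇒∃[o]m+o≡n l≤1+n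
  = <⇒≱ (n<1+n 1) (ℤₚ.drop‿+≤+ (ℤₚ.≤-trans c₁-gain (m≤1+n⇒m-n≤1 c₁-bound)))
  where
  0<a : 0 < a
  0<a = +-cancelˡ-< k 0 a (subst (_< k + a) (sym (+-identityʳ k)) k<l)
  σ = seq π
  τ = σ · blockInterchange 1 j k l
  σ₁≡1×τ₁≢1 : σ 1 ≡ 1 × τ 1 ≢ 1
  σ₁≡1×τ₁≢1 = f-difference≡1 σ τ f-gain
  c₁-bound : c₁ n τ ≤ suc (c₁ n σ)
  c₁-bound = c₁-prefixBlockInterchange-≤ σ (suc c) b a r z<s 0<a (suc-injective l+r≡1+n)
               (seq-≤ π) (seq-positive π) (proj₁ σ₁≡1×τ₁≢1) (proj₂ σ₁≡1×τ₁≢1)
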